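{- For integers $n,r\ge 0$ let $\mathbb{S}(n,r)=\{(u_1,\dots,u_r)\in\mathbb{Z}_{\ge 1}^r : u_1+\dots+u_r=n\}$ (so $\mathbb{S}(0,0)$ consists of the empty tuple), and for nonnegative integers $n_1,n_2,r,s$ let $N(n_1,n_2,r,s)=|\{(\mathbf{u},\mathbf{v})\in\mathbb{S}(n_1,r)\times\mathbb{S}(n_2,r): \sum_{i=1}^r|u_i-v_i|=s\}|$. Then, as formal power series, $$F(x_1,x_2,y,z):=\sum_{n_1,n_2,r,s\ge 0}N(n_1,n_2,r,s)\,x_1^{n_1}x_2^{n_2}y^r z^s=\frac{G(x_1,x_2,y,z)}{H(x_1,x_2,y,z)},$$ where $G=(1-x_1x_2)(1-x_1z)(1-x_2z)$ and $H=(1-x_1x_2)(1-x_1z)(1-x_2z)-yx_1x_2(1-x_1x_2z^2)$. -}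

module Defs where

open import Data.Nat as ℕ using (ℕ; zero; suc; _∸_; _≤_; _≟_; _≤?_; ∣_-_∣; _≡ᵇ_)
open import Data.Bool using (Bool; true; false; if_then_else_; _∧_)
open import Data.Integer as ℤ using (ℤ; +_)
open import Data.List as L using (List; []; _∷_; [_]; upTo; concatMap; filter; cartesianProduct; length)
open import Data.Vec as V using (Vec; zipWith)
open import Data.Vec.Relation.Unary.All as VAll using (All; all?)
open import Data.Product using (_×_; _,_; proj₁; proj₂)
open import Relation.Binary.PropositionalEquality using (_≡_)
open import Relation.Nullary.Decidable using (_×-dec_)

boxes : ℕ → (r : ℕ) → List (Vec ℕ r)
boxes n zero    = [ V.[] ]
boxes n (suc r) = concatMap (λ u → L.map (u V.∷_) (boxes n r)) (upTo (suc n))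

IsComp : (n : ℕ) {r : ℕ} → Vec ℕ r → Set
IsComp n u = All (1 ≤_) u × V.sum u ≡ n

isComp? : (n : ℕ) {r : ℕ} (u : Vec ℕ r) → Relation.Nullary.Decidable.Dec (IsComp n u)
isComp? n u = all? (1 ≤?_) u ×-dec (V.sum u ≟ n)

-- S(n,r) as a list (each composition has entries ≤ n, so none are missed)
S : ℕ → (r : ℕ) → List (Vec ℕ r)
S n r = filter (isComp? n) (boxes n r)

dist : {r : ℕ} → Vec ℕ r → Vec ℕ r → ℕ
dist u v = V.sum (zipWith ∣_-_∣ u v)

N : ℕ → ℕ → ℕ → ℕ → ℕ
N n₁ n₂ r s =
  length (filter (λ p → dist (proj₁ p) (proj₂ p) ≟ s)
                 (cartesianProduct (S n₁ r) (S n₂ r)))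

-- Formal power series in x₁, x₂, y, z over ℤ, as coefficient functions:
-- f a b c d = coefficient of x₁^a x₂^b y^c z^d.

PS : Set
PS = ℕ → ℕ → ℕ → ℕ → ℤ

sumTo : (ℕ → ℤ) → ℕ → ℤ
sumTo f zero    = f zero
sumTo f (suc a) = sumTo f a ℤ.+ f (suc a)

infixl 6 _⊕_ _⊖_
infixl 7 _⊛_

_⊕_ : PS → PS → PS
(f ⊕ g) a b c d = f a b c d ℤ.+ g a b c d

_⊖_ : PS → PS → PS
(f ⊖ g) a b c d = f a b c d ℤ.- g a b c d

_⊛_ : PS → PS → PS
(f ⊛ g) a b c d =
  sumTo (λ i → sumTo (λ j → sumTo (λ k → sumTo (λ l →
    f i j k l ℤ.* g (a ∸ i) (b ∸ j) (c ∸ k) (d ∸ l)) d) c) b) a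

mono : ℕ → ℕ → ℕ → ℕ → PS
mono e₁ e₂ e₃ e₄ a b c d =
  if (a ≡ᵇ e₁) ∧ (b ≡ᵇ e₂) ∧ (c ≡ᵇ e₃) ∧ (d ≡ᵇ e₄) then + 1 else + 0

𝟙 x₁ x₂ y z : PS
𝟙  = mono 0 0 0 0
x₁ = mono 1 0 0 0
x₂ = mono 0 1 0 0
y  = mono 0 0 1 0
z  = mono 0 0 0 1

F : PS
F n₁ n₂ r s = + N n₁ n₂ r s

G : PS
G = (𝟙 ⊖ x₁ ⊛ x₂) ⊛ (𝟙 ⊖ x₁ ⊛ z) ⊛ (𝟙 ⊖ x₂ ⊛ z)

H : PS
H = (𝟙 ⊖ x₁ ⊛ x₂) ⊛ (𝟙 ⊖ x₁ ⊛ z) ⊛ (𝟙 ⊖ x₂ ⊛ z)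
    ⊖ y ⊛ x₁ ⊛ x₂ ⊛ (𝟙 ⊖ x₁ ⊛ x₂ ⊛ z ⊛ z)

module Submission where

open import Defs
open import Data.Bool using (Bool; true; false; if_then_else_; _∧_)
open import Data.Bool.Properties using (∧-zeroʳ)
open import Data.Bool.Solver using (module ∨-∧-Solver)
open import Data.Empty using (⊥-elim)
open import Data.Integer as ℤ using (ℤ; +_; _+_; _*_; -_; _-_)
import Data.Integer.Properties as ℤ
open import Data.Integer.Tactic.RingSolver using (solve-∀)
open import Data.List as List
  using (List; []; _∷_; _++_; length; filter; cartesianProduct; concatMap; applyUpTo; upTo)
open import Data.Nat as ℕ using (ℕ; zero; suc; _∸_; _≤_; _≤′_; ≤′-refl; ≤′-step; _≤ᵇ_; _≡ᵇ_; ∣_-_∣)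
import Data.Nat.Properties as ℕ
open import Data.Product using (_×_; _,_; proj₁; proj₂)
open import Data.Vec as Vec using (Vec)
open import Level using (0ℓ)
open import Relation.Binary.Bundles using (Setoid)
import Relation.Binary.Reasoning.Setoid
open import Relation.Binary.PropositionalEquality
open import Relation.Nullary using (does)
open import Relation.Unary using (Decidable)

-- Cutting off the first parts (x, w) of a pair of compositions gives F = 1 + y·P·F, where
-- P = Σ_{i,j ≥ 1} x₁^i x₂^j z^|i−j|.  Multiplying P by 1 − x₁x₂ leaves only its first row and
-- column, because the diagonal shift (i, j) ↦ (i+1, j+1) preserves |i − j|; the factors 1 − x₂z
-- and 1 − x₁z then telescope what is left, so that G·P = x₁x₂(1 − x₁x₂z²) and hence y·G·P = G − H.
-- Therefore H·F = G·F − y·G·P·F = G·(F − y·P·F) = G.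
-- Only polynomial factors are ever reassociated: a monomial acts on a series as a shift of the
-- coefficients, which commutes with the Cauchy product.

when : Bool → ℤ → ℤ
when β x = if β then x else + 0

𝕀 : Bool → ℤ
𝕀 β = when β (+ 1)

when-∧ : ∀ β γ x → when (β ∧ γ) x ≡ when β (when γ x)
when-∧ true  γ x = refl
when-∧ false γ x = refl

when-∧³ : ∀ β γ δ ε x → when (β ∧ γ ∧ δ ∧ ε) x ≡ when β (when γ (when δ (when ε x)))
when-∧³ β γ δ ε x =
  trans (when-∧ β _ x) (cong (when β) (trans (when-∧ γ _ x) (cong (when γ) (when-∧ δ ε x))))

when-+ : ∀ β x y → when β (x + y) ≡ when β x + when β y
when-+ true  x y = refl
when-+ false x y = refl

when-*ˡ : ∀ β x y → when β x * y ≡ when β (x * y)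
when-*ˡ true  x y = refl
when-*ˡ false x y = refl

𝕀-*ˡ : ∀ β x → 𝕀 β * x ≡ when β x
𝕀-*ˡ true  x = ℤ.*-identityˡ x
𝕀-*ˡ false x = refl

when-zero : ∀ β → when β (+ 0) ≡ + 0
when-zero true  = refl
when-zero false = refl

when-≤ : ∀ {m n} x → m ≤ n → when (m ≤ᵇ n) x ≡ x
when-≤ {m} {n} x m≤n with m ≤ᵇ n | ℕ.≤⇒≤ᵇ m≤n
... | true | _ = refl

when-> : ∀ {m n} x → n ℕ.< m → when (m ≤ᵇ n) x ≡ + 0
when-> {m} {n} x n<m with m ≤ᵇ n | ℕ.≤ᵇ⇒≤ m n
... | false | _   = refl
... | true  | m≤n = ⊥-elim (ℕ.<⇒≱ n<m (m≤n _))

-- Not definitional, since _≤ᵇ_ is defined through _<ᵇ_.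
suc-≤ᵇ-suc : ∀ m n → (suc m ≤ᵇ suc n) ≡ (m ≤ᵇ n)
suc-≤ᵇ-suc zero    n = refl
suc-≤ᵇ-suc (suc m) n = refl

+-≡ᵇ : ∀ m n k → (m ℕ.+ n ≡ᵇ k) ≡ ((m ≤ᵇ k) ∧ (n ≡ᵇ k ∸ m))
+-≡ᵇ zero    n k       = refl
+-≡ᵇ (suc m) n zero    = refl
+-≡ᵇ (suc m) n (suc k) = trans (+-≡ᵇ m n k) (cong (_∧ (n ≡ᵇ k ∸ m)) (sym (suc-≤ᵇ-suc m k)))

≡ᵇ-+ : ∀ k m n → (k ≡ᵇ m ℕ.+ n) ≡ ((m ≤ᵇ k) ∧ (k ∸ m ≡ᵇ n))
≡ᵇ-+ k       zero    n = refl
≡ᵇ-+ zero    (suc m) n = refl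
≡ᵇ-+ (suc k) (suc m) n = trans (≡ᵇ-+ k m n) (cong (_∧ (k ∸ m ≡ᵇ n)) (sym (suc-≤ᵇ-suc m k)))

sumTo-cong-≤ : ∀ {f g : ℕ → ℤ} n → (∀ i → i ≤ n → f i ≡ g i) → sumTo f n ≡ sumTo g n
sumTo-cong-≤ zero    f≗g = f≗g 0 ℕ.z≤n
sumTo-cong-≤ (suc n) f≗g =
  cong₂ _+_ (sumTo-cong-≤ n (λ i i≤n → f≗g i (ℕ.m≤n⇒m≤1+n i≤n))) (f≗g (suc n) ℕ.≤-refl)

sumTo-cong : ∀ {f g : ℕ → ℤ} → (∀ i → f i ≡ g i) → ∀ n → sumTo f n ≡ sumTo g n
sumTo-cong f≗g n = sumTo-cong-≤ n (λ i _ → f≗g i)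

sumTo-zipWith : (_∙_ : ℤ → ℤ → ℤ) → (∀ p q r s → (p ∙ q) + (r ∙ s) ≡ (p + r) ∙ (q + s)) →
                ∀ f g n → sumTo (λ i → f i ∙ g i) n ≡ sumTo f n ∙ sumTo g n
sumTo-zipWith _∙_ medial f g zero    = refl
sumTo-zipWith _∙_ medial f g (suc n) =
  trans (cong (_+ (f (suc n) ∙ g (suc n))) (sumTo-zipWith _∙_ medial f g n)) (medial _ _ _ _)

sumTo-when : ∀ β f n → sumTo (λ i → when β (f i)) n ≡ when β (sumTo f n)
sumTo-when β f zero    = refl
sumTo-when β f (suc n) = trans (cong (_+ when β (f (suc n))) (sumTo-when β f n)) (sym (when-+ β _ _))

sumTo²-when : ∀ β (f : ℕ → ℕ → ℤ) m n →
  sumTo (λ i → sumTo (λ j → when β (f i j)) m) n ≡ when β (sumTo (λ i → sumTo (f i) m) n)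
sumTo²-when β f m n = trans (sumTo-cong (λ i → sumTo-when β (f i) m) n) (sumTo-when β _ n)

sumTo³-when : ∀ β (f : ℕ → ℕ → ℕ → ℤ) l m n →
  sumTo (λ i → sumTo (λ j → sumTo (λ k → when β (f i j k)) l) m) n ≡
  when β (sumTo (λ i → sumTo (λ j → sumTo (f i j) l) m) n)
sumTo³-when β f l m n = trans (sumTo-cong (λ i → sumTo²-when β (f i) l m) n) (sumTo-when β _ n)

sumTo-zero : ∀ n → sumTo (λ _ → + 0) n ≡ + 0
sumTo-zero zero    = refl
sumTo-zero (suc n) = cong (_+ + 0) (sumTo-zero n)

sumTo-head : ∀ {f : ℕ → ℤ} → (∀ i → f (suc i) ≡ + 0) → ∀ n → sumTo f n ≡ f 0
sumTo-head f-tail zero    = refl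
sumTo-head f-tail (suc n) = trans (cong₂ _+_ (sumTo-head f-tail n) (f-tail n)) (ℤ.+-identityʳ _)

sumTo-suc : ∀ (f : ℕ → ℤ) n → sumTo f (suc n) ≡ f 0 + sumTo (λ i → f (suc i)) n
sumTo-suc f zero    = refl
sumTo-suc f (suc n) = trans (cong (_+ f (suc (suc n))) (sumTo-suc f n)) (ℤ.+-assoc (f 0) _ _)

sumTo-reverse : ∀ n (φ : ℕ → ℕ → ℤ) → sumTo (λ i → φ i (n ∸ i)) n ≡ sumTo (λ i → φ (n ∸ i) i) n
sumTo-reverse zero    φ = refl
sumTo-reverse (suc n) φ = begin
    sumTo (λ i → φ i (suc n ∸ i)) (suc n)
  ≡⟨ sumTo-suc (λ i → φ i (suc n ∸ i)) n ⟩
    φ 0 (suc n) + sumTo (λ i → φ (suc i) (n ∸ i)) n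
  ≡⟨ cong (λ t → φ 0 (suc n) + t) (sumTo-reverse n (λ i → φ (suc i))) ⟩
    φ 0 (suc n) + sumTo (λ i → φ (suc (n ∸ i)) i) n
  ≡⟨ ℤ.+-comm (φ 0 (suc n)) _ ⟩
    sumTo (λ i → φ (suc (n ∸ i)) i) n + φ 0 (suc n)
  ≡⟨ cong₂ _+_ (sumTo-cong-≤ n (λ i i≤n → cong (λ k → φ k i) (sym (ℕ.+-∸-assoc 1 i≤n))))
               (cong (λ k → φ k (suc n)) (sym (ℕ.n∸n≡0 n))) ⟩
    sumTo (λ i → φ (suc n ∸ i) i) (suc n)
  ∎
  where open ≡-Reasoning

sumTo-δ : ∀ e a (X : ℕ → ℤ) → sumTo (λ i → when (i ≡ᵇ e) (X i)) a ≡ when (e ≤ᵇ a) (X e)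
sumTo-δ zero    zero    X = refl
sumTo-δ (suc e) zero    X = refl
sumTo-δ zero    (suc a) X =
  trans (sumTo-suc _ a) (trans (cong (λ t → X 0 + t) (sumTo-zero a)) (ℤ.+-identityʳ (X 0)))
sumTo-δ (suc e) (suc a) X =
  trans (sumTo-suc _ a) (trans (ℤ.+-identityˡ _)
    (trans (sumTo-δ e a (λ i → X (suc i))) (cong (λ β → when β (X (suc e))) (sym (suc-≤ᵇ-suc e a)))))

sumTo-shift : ∀ e a (K : ℕ → ℕ → ℤ) →
  sumTo (λ i → when (e ≤ᵇ i) (K (i ∸ e) (a ∸ i))) a ≡ when (e ≤ᵇ a) (sumTo (λ i → K i (a ∸ e ∸ i)) (a ∸ e))
sumTo-shift zero    a       K = refl
sumTo-shift (suc e) zero    K = refl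
sumTo-shift (suc e) (suc a) K =
  trans (sumTo-suc _ a) (trans (ℤ.+-identityˡ _)
    (trans (sumTo-cong (λ i → cong (λ β → when β (K (i ∸ e) (a ∸ i))) (suc-≤ᵇ-suc e i)) a)
    (trans (sumTo-shift e a K)
           (cong (λ β → when β (sumTo (λ i → K i (a ∸ e ∸ i)) (a ∸ e))) (sym (suc-≤ᵇ-suc e a))))))

sumTo-truncate : ∀ {a A} (g : ℕ → ℤ) → a ≤ A → sumTo (λ x → when (x ≤ᵇ a) (g x)) A ≡ sumTo g a
sumTo-truncate {a} g a≤A = go (ℕ.≤⇒≤′ a≤A)
  where
  go : ∀ {A} → a ≤′ A → sumTo (λ x → when (x ≤ᵇ a) (g x)) A ≡ sumTo g a
  go ≤′-refl              = sumTo-cong-≤ a (λ x x≤a → when-≤ (g x) x≤a)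
  go (≤′-step {A} a≤′A) =
    trans (cong₂ _+_ (go a≤′A) (when-> (g (suc A)) (ℕ.s≤s (ℕ.≤′⇒≤ a≤′A)))) (ℤ.+-identityʳ _)

infix 4 _≐_
_≐_ : PS → PS → Set
f ≐ g = ∀ a b c d → f a b c d ≡ g a b c d

≐-setoid : Setoid 0ℓ 0ℓ
≐-setoid = record
  { Carrier       = PS
  ; _≈_           = _≐_
  ; isEquivalence = record
    { refl  = λ a b c d → refl
    ; sym   = λ f≐g a b c d → sym (f≐g a b c d)
    ; trans = λ f≐g g≐h a b c d → trans (f≐g a b c d) (g≐h a b c d)
    }
  }

open Setoid ≐-setoid using () renaming (refl to ≐-refl; sym to ≐-sym; trans to ≐-trans)
module ≐-Reasoning = Relation.Binary.Reasoning.Setoid ≐-setoid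

⊕-cong : ∀ {f f′ g g′} → f ≐ f′ → g ≐ g′ → f ⊕ g ≐ f′ ⊕ g′
⊕-cong f≐f′ g≐g′ a b c d = cong₂ _+_ (f≐f′ a b c d) (g≐g′ a b c d)

⊖-cong : ∀ {f f′ g g′} → f ≐ f′ → g ≐ g′ → f ⊖ g ≐ f′ ⊖ g′
⊖-cong f≐f′ g≐g′ a b c d = cong₂ _-_ (f≐f′ a b c d) (g≐g′ a b c d)

Σ⁴ : ℕ → ℕ → ℕ → ℕ → (ℕ → ℕ → ℕ → ℕ → ℤ) → ℤ
Σ⁴ a b c d T = sumTo (λ i → sumTo (λ j → sumTo (λ k → sumTo (λ l → T i j k l) d) c) b) a

Σ⁴-cong : ∀ {T U : ℕ → ℕ → ℕ → ℕ → ℤ} → (∀ i j k l → T i j k l ≡ U i j k l) →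
          ∀ a b c d → Σ⁴ a b c d T ≡ Σ⁴ a b c d U
Σ⁴-cong T≗U a b c d =
  sumTo-cong (λ i → sumTo-cong (λ j → sumTo-cong (λ k → sumTo-cong (T≗U i j k) d) c) b) a

Σ⁴-zipWith : (_∙_ : ℤ → ℤ → ℤ) → (∀ p q r s → (p ∙ q) + (r ∙ s) ≡ (p + r) ∙ (q + s)) → ∀ T U a b c d →
             Σ⁴ a b c d (λ i j k l → T i j k l ∙ U i j k l) ≡ Σ⁴ a b c d T ∙ Σ⁴ a b c d U
Σ⁴-zipWith _∙_ medial T U a b c d =
  trans (sumTo-cong (λ i →
    trans (sumTo-cong (λ j →
      trans (sumTo-cong (λ k → zip (T i j k) (U i j k) d) c) (zip _ _ c)) b) (zip _ _ b)) a) (zip _ _ a)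
  where zip = sumTo-zipWith _∙_ medial

Σ⁴-guards : ∀ (p q r s : ℕ → Bool) (T : ℕ → ℕ → ℕ → ℕ → ℤ) a b c d →
  Σ⁴ a b c d (λ i j k l → when (p i) (when (q j) (when (r k) (when (s l) (T i j k l))))) ≡
  sumTo (λ i → when (p i) (sumTo (λ j → when (q j) (sumTo (λ k → when (r k)
    (sumTo (λ l → when (s l) (T i j k l)) d)) c)) b)) a
Σ⁴-guards p q r s T a b c d = sumTo-cong (λ i →
  trans (sumTo³-when (p i) _ d c b) (cong (when (p i)) (sumTo-cong (λ j →
  trans (sumTo²-when (q j) _ d c) (cong (when (q j)) (sumTo-cong (λ k →
  sumTo-when (r k) _ d) c))) b))) a

⊛-congˡ : ∀ {f f′} g → f ≐ f′ → f ⊛ g ≐ f′ ⊛ g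
⊛-congˡ g f≐f′ a b c d =
  Σ⁴-cong (λ i j k l → cong (_* g (a ∸ i) (b ∸ j) (c ∸ k) (d ∸ l)) (f≐f′ i j k l)) a b c d

⊛-congʳ : ∀ f {g g′} → g ≐ g′ → f ⊛ g ≐ f ⊛ g′
⊛-congʳ f g≐g′ a b c d = Σ⁴-cong (λ i j k l → cong (f i j k l *_) (g≐g′ _ _ _ _)) a b c d

⊛-cong : ∀ {f f′ g g′} → f ≐ f′ → g ≐ g′ → f ⊛ g ≐ f′ ⊛ g′
⊛-cong {f′ = f′} {g = g} f≐f′ g≐g′ = ≐-trans (⊛-congˡ g f≐f′) (⊛-congʳ f′ g≐g′)

⊛-comm : ∀ f g → f ⊛ g ≐ g ⊛ f
⊛-comm f g a b c d =
  trans (sumTo-reverse a (λ i m → Σ³ b c d (λ j k l → f i j k l * g m (b ∸ j) (c ∸ k) (d ∸ l))))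
  (sumTo-cong (λ i →
    trans (sumTo-reverse b (λ j m → Σ² c d (λ k l → f (a ∸ i) j k l * g i m (c ∸ k) (d ∸ l))))
    (sumTo-cong (λ j →
      trans (sumTo-reverse c (λ k m → sumTo (λ l → f (a ∸ i) (b ∸ j) k l * g i j m (d ∸ l)) d))
      (sumTo-cong (λ k →
        trans (sumTo-reverse d (λ l m → f (a ∸ i) (b ∸ j) (c ∸ k) l * g i j k m))
        (sumTo-cong (λ l → ℤ.*-comm (f (a ∸ i) (b ∸ j) (c ∸ k) (d ∸ l)) (g i j k l)) d)) c)) b)) a)
  where
  Σ² : ℕ → ℕ → (ℕ → ℕ → ℤ) → ℤ
  Σ² c d T = sumTo (λ k → sumTo (T k) d) c
  Σ³ : ℕ → ℕ → ℕ → (ℕ → ℕ → ℕ → ℤ) → ℤ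
  Σ³ b c d T = sumTo (λ j → Σ² c d (T j)) b

⊛-distribʳ-⊕ : ∀ f g h → (f ⊕ g) ⊛ h ≐ f ⊛ h ⊕ g ⊛ h
⊛-distribʳ-⊕ f g h a b c d =
  trans (Σ⁴-cong (λ i j k l → ℤ.*-distribʳ-+ (h (a ∸ i) (b ∸ j) (c ∸ k) (d ∸ l)) (f i j k l) (g i j k l))
                 a b c d)
        (Σ⁴-zipWith _+_ medial _ _ a b c d)
  where
  medial : ∀ p q r s → (p + q) + (r + s) ≡ (p + r) + (q + s)
  medial = solve-∀

⊛-distribʳ-⊖ : ∀ f g h → (f ⊖ g) ⊛ h ≐ f ⊛ h ⊖ g ⊛ h
⊛-distribʳ-⊖ f g h a b c d =
  trans (Σ⁴-cong (λ i j k l → distrib (f i j k l) (g i j k l) (h (a ∸ i) (b ∸ j) (c ∸ k) (d ∸ l))) a b c d)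
        (Σ⁴-zipWith _-_ medial _ _ a b c d)
  where
  distrib : ∀ p q r → (p - q) * r ≡ p * r - q * r
  distrib = solve-∀
  medial : ∀ p q r s → (p - q) + (r - s) ≡ (p + r) - (q + s)
  medial = solve-∀

⊛-distribˡ-⊕ : ∀ h f g → h ⊛ (f ⊕ g) ≐ h ⊛ f ⊕ h ⊛ g
⊛-distribˡ-⊕ h f g =
  ≐-trans (⊛-comm h (f ⊕ g)) (≐-trans (⊛-distribʳ-⊕ f g h) (⊕-cong (⊛-comm f h) (⊛-comm g h)))

⊛-distribˡ-⊖ : ∀ h f g → h ⊛ (f ⊖ g) ≐ h ⊛ f ⊖ h ⊛ g
⊛-distribˡ-⊖ h f g =
  ≐-trans (⊛-comm h (f ⊖ g)) (≐-trans (⊛-distribʳ-⊖ f g h) (⊖-cong (⊛-comm f h) (⊛-comm g h)))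

-- Monomials act by shifting

shift : ℕ → ℕ → ℕ → ℕ → PS → PS
shift e₁ e₂ e₃ e₄ f a b c d =
  when (e₁ ≤ᵇ a) (when (e₂ ≤ᵇ b) (when (e₃ ≤ᵇ c) (when (e₄ ≤ᵇ d) (f (a ∸ e₁) (b ∸ e₂) (c ∸ e₃) (d ∸ e₄)))))

shift-cong : ∀ e₁ e₂ e₃ e₄ {f g} → f ≐ g → shift e₁ e₂ e₃ e₄ f ≐ shift e₁ e₂ e₃ e₄ g
shift-cong e₁ e₂ e₃ e₄ f≐g a b c d =
  cong (λ t → when (e₁ ≤ᵇ a) (when (e₂ ≤ᵇ b) (when (e₃ ≤ᵇ c) (when (e₄ ≤ᵇ d) t))))
       (f≐g (a ∸ e₁) (b ∸ e₂) (c ∸ e₃) (d ∸ e₄))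

shift-zero : ∀ e₁ e₂ e₃ e₄ f a b c d → f (a ∸ e₁) (b ∸ e₂) (c ∸ e₃) (d ∸ e₄) ≡ + 0 →
             shift e₁ e₂ e₃ e₄ f a b c d ≡ + 0
shift-zero e₁ e₂ e₃ e₄ f a b c d f≡0 rewrite f≡0 =
  trans (cong (when (e₁ ≤ᵇ a)) (trans (cong (when (e₂ ≤ᵇ b))
    (trans (cong (when (e₃ ≤ᵇ c)) (when-zero (e₄ ≤ᵇ d))) (when-zero (e₃ ≤ᵇ c)))) (when-zero (e₂ ≤ᵇ b))))
    (when-zero (e₁ ≤ᵇ a))

mono-⊛ : ∀ e₁ e₂ e₃ e₄ g → mono e₁ e₂ e₃ e₄ ⊛ g ≐ shift e₁ e₂ e₃ e₄ g
mono-⊛ e₁ e₂ e₃ e₄ g a b c d =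
  trans (Σ⁴-cong (λ i j k l → trans (𝕀-*ˡ ((i ≡ᵇ e₁) ∧ (j ≡ᵇ e₂) ∧ (k ≡ᵇ e₃) ∧ (l ≡ᵇ e₄)) (g′ i j k l))
                                     (when-∧³ (i ≡ᵇ e₁) (j ≡ᵇ e₂) (k ≡ᵇ e₃) (l ≡ᵇ e₄) (g′ i j k l))) a b c d)
  (trans (Σ⁴-guards (_≡ᵇ e₁) (_≡ᵇ e₂) (_≡ᵇ e₃) (_≡ᵇ e₄) g′ a b c d)
  (trans (sumTo-δ e₁ a _) (cong (when (e₁ ≤ᵇ a))
  (trans (sumTo-δ e₂ b _) (cong (when (e₂ ≤ᵇ b))
  (trans (sumTo-δ e₃ c _) (cong (when (e₃ ≤ᵇ c))
  (sumTo-δ e₄ d _))))))))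
  where
  g′ : ℕ → ℕ → ℕ → ℕ → ℤ
  g′ i j k l = g (a ∸ i) (b ∸ j) (c ∸ k) (d ∸ l)

shift-⊛ : ∀ e₁ e₂ e₃ e₄ g h → shift e₁ e₂ e₃ e₄ g ⊛ h ≐ shift e₁ e₂ e₃ e₄ (g ⊛ h)
shift-⊛ e₁ e₂ e₃ e₄ g h a b c d =
  trans (Σ⁴-cong guards-out a b c d)
  (trans (Σ⁴-guards (e₁ ≤ᵇ_) (e₂ ≤ᵇ_) (e₃ ≤ᵇ_) (e₄ ≤ᵇ_) _ a b c d)
  (trans (sumTo-shift e₁ a K₁) (cong (when (e₁ ≤ᵇ a))
  (trans (sumTo-cong (λ i → sumTo-shift e₂ b (K₂ i (a′ ∸ i))) a′)
  (trans (sumTo-when (e₂ ≤ᵇ b) _ a′) (cong (when (e₂ ≤ᵇ b))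
  (trans (sumTo-cong (λ i → sumTo-cong (λ j → sumTo-shift e₃ c (K₃ i (a′ ∸ i) j (b′ ∸ j))) b′) a′)
  (trans (sumTo²-when (e₃ ≤ᵇ c) _ b′ a′) (cong (when (e₃ ≤ᵇ c))
  (trans (sumTo-cong (λ i → sumTo-cong (λ j → sumTo-cong (λ k →
            sumTo-shift e₄ d (λ l p → g i j k l * h (a′ ∸ i) (b′ ∸ j) (c′ ∸ k) p)) c′) b′) a′)
  (sumTo³-when (e₄ ≤ᵇ d) _ c′ b′ a′)))))))))))
  where
  a′ = a ∸ e₁
  b′ = b ∸ e₂
  c′ = c ∸ e₃
  K₃ : ℕ → ℕ → ℕ → ℕ → ℕ → ℕ → ℤ
  K₃ i m j n k o = sumTo (λ l → when (e₄ ≤ᵇ l) (g i j k (l ∸ e₄) * h m n o (d ∸ l))) d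
  K₂ : ℕ → ℕ → ℕ → ℕ → ℤ
  K₂ i m j n = sumTo (λ k → when (e₃ ≤ᵇ k) (K₃ i m j n (k ∸ e₃) (c ∸ k))) c
  K₁ : ℕ → ℕ → ℤ
  K₁ i m = sumTo (λ j → when (e₂ ≤ᵇ j) (K₂ i m (j ∸ e₂) (b ∸ j))) b
  guards-out : ∀ i j k l → shift e₁ e₂ e₃ e₄ g i j k l * h (a ∸ i) (b ∸ j) (c ∸ k) (d ∸ l) ≡
    when (e₁ ≤ᵇ i) (when (e₂ ≤ᵇ j) (when (e₃ ≤ᵇ k) (when (e₄ ≤ᵇ l)
      (g (i ∸ e₁) (j ∸ e₂) (k ∸ e₃) (l ∸ e₄) * h (a ∸ i) (b ∸ j) (c ∸ k) (d ∸ l)))))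
  guards-out i j k l =
    trans (when-*ˡ (e₁ ≤ᵇ i) _ x) (cong (when (e₁ ≤ᵇ i))
    (trans (when-*ˡ (e₂ ≤ᵇ j) _ x) (cong (when (e₂ ≤ᵇ j))
    (trans (when-*ˡ (e₃ ≤ᵇ k) _ x) (cong (when (e₃ ≤ᵇ k)) (when-*ˡ (e₄ ≤ᵇ l) _ x))))))
    where x = h (a ∸ i) (b ∸ j) (c ∸ k) (d ∸ l)

mono-⊛-mono : ∀ e₁ e₂ e₃ e₄ e₁′ e₂′ e₃′ e₄′ →
  mono e₁ e₂ e₃ e₄ ⊛ mono e₁′ e₂′ e₃′ e₄′ ≐ mono (e₁ ℕ.+ e₁′) (e₂ ℕ.+ e₂′) (e₃ ℕ.+ e₃′) (e₄ ℕ.+ e₄′)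
mono-⊛-mono e₁ e₂ e₃ e₄ e₁′ e₂′ e₃′ e₄′ a b c d =
  trans (mono-⊛ e₁ e₂ e₃ e₄ (mono e₁′ e₂′ e₃′ e₄′) a b c d)
  (trans (sym (when-∧³ l₁ l₂ l₃ l₄ _))
  (trans (sym (when-∧ (l₁ ∧ l₂ ∧ l₃ ∧ l₄) (q₁ ∧ q₂ ∧ q₃ ∧ q₄) (+ 1)))
  (cong 𝕀 (trans (interleave l₁ l₂ l₃ l₄ q₁ q₂ q₃ q₄)
    (sym (cong₂ _∧_ (≡ᵇ-+ a e₁ e₁′)
         (cong₂ _∧_ (≡ᵇ-+ b e₂ e₂′) (cong₂ _∧_ (≡ᵇ-+ c e₃ e₃′) (≡ᵇ-+ d e₄ e₄′)))))))))
  where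
  l₁ = e₁ ≤ᵇ a
  l₂ = e₂ ≤ᵇ b
  l₃ = e₃ ≤ᵇ c
  l₄ = e₄ ≤ᵇ d
  q₁ = a ∸ e₁ ≡ᵇ e₁′
  q₂ = b ∸ e₂ ≡ᵇ e₂′
  q₃ = c ∸ e₃ ≡ᵇ e₃′
  q₄ = d ∸ e₄ ≡ᵇ e₄′
  open ∨-∧-Solver
  interleave : ∀ l₁ l₂ l₃ l₄ q₁ q₂ q₃ q₄ →
    (l₁ ∧ l₂ ∧ l₃ ∧ l₄) ∧ (q₁ ∧ q₂ ∧ q₃ ∧ q₄) ≡ (l₁ ∧ q₁) ∧ (l₂ ∧ q₂) ∧ (l₃ ∧ q₃) ∧ (l₄ ∧ q₄)
  interleave = solve 8 (λ l₁ l₂ l₃ l₄ q₁ q₂ q₃ q₄ →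
    (l₁ :* (l₂ :* (l₃ :* l₄))) :* (q₁ :* (q₂ :* (q₃ :* q₄))) :=
    (l₁ :* q₁) :* ((l₂ :* q₂) :* ((l₃ :* q₃) :* (l₄ :* q₄)))) refl

mono-y-free : ∀ e₁ e₂ e₄ a b c d → mono e₁ e₂ 0 e₄ a b (suc c) d ≡ + 0
mono-y-free e₁ e₂ e₄ a b c d = cong 𝕀 (trans (cong ((a ≡ᵇ e₁) ∧_) (∧-zeroʳ (b ≡ᵇ e₂))) (∧-zeroʳ (a ≡ᵇ e₁)))

⊛-identityˡ : ∀ f → 𝟙 ⊛ f ≐ f
⊛-identityˡ = mono-⊛ 0 0 0 0

⊛-identityʳ : ∀ f → f ⊛ 𝟙 ≐ f
⊛-identityʳ f = ≐-trans (⊛-comm f 𝟙) (⊛-identityˡ f)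

Δ : ℕ → ℕ → ℕ → ℕ → PS → PS
Δ e₁ e₂ e₃ e₄ f = f ⊖ shift e₁ e₂ e₃ e₄ f

Δ-cong : ∀ e₁ e₂ e₃ e₄ {f g} → f ≐ g → Δ e₁ e₂ e₃ e₄ f ≐ Δ e₁ e₂ e₃ e₄ g
Δ-cong e₁ e₂ e₃ e₄ f≐g = ⊖-cong f≐g (shift-cong e₁ e₂ e₃ e₄ f≐g)

Δ-beyond : ∀ e₁ e₂ e₃ e₄ f a b c d → f (a ∸ e₁) (b ∸ e₂) (c ∸ e₃) (d ∸ e₄) ≡ + 0 →
           Δ e₁ e₂ e₃ e₄ f a b c d ≡ f a b c d
Δ-beyond e₁ e₂ e₃ e₄ f a b c d f≡0 =
  trans (cong (λ t → f a b c d - t) (shift-zero e₁ e₂ e₃ e₄ f a b c d f≡0)) (ℤ.+-identityʳ _)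

one-minus-⊛ : ∀ e₁ e₂ e₃ e₄ e₁′ e₂′ e₃′ e₄′ f →
  (𝟙 ⊖ mono e₁ e₂ e₃ e₄ ⊛ mono e₁′ e₂′ e₃′ e₄′) ⊛ f ≐
  Δ (e₁ ℕ.+ e₁′) (e₂ ℕ.+ e₂′) (e₃ ℕ.+ e₃′) (e₄ ℕ.+ e₄′) f
one-minus-⊛ e₁ e₂ e₃ e₄ e₁′ e₂′ e₃′ e₄′ f =
  ≐-trans (⊛-distribʳ-⊖ 𝟙 _ f)
  (⊖-cong (⊛-identityˡ f)
    (≐-trans (⊛-congˡ f (mono-⊛-mono e₁ e₂ e₃ e₄ e₁′ e₂′ e₃′ e₄′)) (mono-⊛ _ _ _ _ f)))

-- Associativity with a polynomial on the left

Associates : PS → Set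
Associates f = ∀ g h → f ⊛ (g ⊛ h) ≐ (f ⊛ g) ⊛ h

mono-associates : ∀ e₁ e₂ e₃ e₄ → Associates (mono e₁ e₂ e₃ e₄)
mono-associates e₁ e₂ e₃ e₄ g h = begin
  mono e₁ e₂ e₃ e₄ ⊛ (g ⊛ h)    ≈⟨ mono-⊛ e₁ e₂ e₃ e₄ (g ⊛ h) ⟩
  shift e₁ e₂ e₃ e₄ (g ⊛ h)     ≈⟨ shift-⊛ e₁ e₂ e₃ e₄ g h ⟨
  shift e₁ e₂ e₃ e₄ g ⊛ h       ≈⟨ ⊛-congˡ h (mono-⊛ e₁ e₂ e₃ e₄ g) ⟨
  (mono e₁ e₂ e₃ e₄ ⊛ g) ⊛ h    ∎
  where open ≐-Reasoning

⊖-associates : ∀ {f g} → Associates f → Associates g → Associates (f ⊖ g)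
⊖-associates {f} {g} f-assoc g-assoc k h = begin
  (f ⊖ g) ⊛ (k ⊛ h)              ≈⟨ ⊛-distribʳ-⊖ f g (k ⊛ h) ⟩
  f ⊛ (k ⊛ h) ⊖ g ⊛ (k ⊛ h)      ≈⟨ ⊖-cong (f-assoc k h) (g-assoc k h) ⟩
  (f ⊛ k) ⊛ h ⊖ (g ⊛ k) ⊛ h      ≈⟨ ⊛-distribʳ-⊖ (f ⊛ k) (g ⊛ k) h ⟨
  (f ⊛ k ⊖ g ⊛ k) ⊛ h            ≈⟨ ⊛-congˡ h (⊛-distribʳ-⊖ f g k) ⟨
  ((f ⊖ g) ⊛ k) ⊛ h              ∎
  where open ≐-Reasoning

⊛-associates : ∀ {f g} → Associates f → Associates g → Associates (f ⊛ g)
⊛-associates {f} {g} f-assoc g-assoc k h = begin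
  (f ⊛ g) ⊛ (k ⊛ h)    ≈⟨ f-assoc g (k ⊛ h) ⟨
  f ⊛ (g ⊛ (k ⊛ h))    ≈⟨ ⊛-congʳ f (g-assoc k h) ⟩
  f ⊛ ((g ⊛ k) ⊛ h)    ≈⟨ f-assoc (g ⊛ k) h ⟩
  (f ⊛ (g ⊛ k)) ⊛ h    ≈⟨ ⊛-congˡ h (f-assoc g k) ⟩
  ((f ⊛ g) ⊛ k) ⊛ h    ∎
  where open ≐-Reasoning

one-minus-associates : ∀ e₁ e₂ e₃ e₄ e₁′ e₂′ e₃′ e₄′ →
                       Associates (𝟙 ⊖ mono e₁ e₂ e₃ e₄ ⊛ mono e₁′ e₂′ e₃′ e₄′)
one-minus-associates e₁ e₂ e₃ e₄ e₁′ e₂′ e₃′ e₄′ =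
  ⊖-associates {𝟙} {mono e₁ e₂ e₃ e₄ ⊛ mono e₁′ e₂′ e₃′ e₄′} (mono-associates 0 0 0 0)
    (⊛-associates {mono e₁ e₂ e₃ e₄} {mono e₁′ e₂′ e₃′ e₄′}
                  (mono-associates e₁ e₂ e₃ e₄) (mono-associates e₁′ e₂′ e₃′ e₄′))

⊛-rotate : ∀ {g h} → Associates g → Associates h → ∀ f p → ((f ⊛ g) ⊛ h) ⊛ p ≐ g ⊛ (h ⊛ (f ⊛ p))
⊛-rotate {g} {h} g-assoc h-assoc f p = begin
  ((f ⊛ g) ⊛ h) ⊛ p    ≈⟨ ⊛-congˡ p (⊛-comm (f ⊛ g) h) ⟩
  (h ⊛ (f ⊛ g)) ⊛ p    ≈⟨ ⊛-congˡ p (h-assoc f g) ⟩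
  ((h ⊛ f) ⊛ g) ⊛ p    ≈⟨ ⊛-congˡ p (⊛-comm (h ⊛ f) g) ⟩
  (g ⊛ (h ⊛ f)) ⊛ p    ≈⟨ g-assoc (h ⊛ f) p ⟨
  g ⊛ ((h ⊛ f) ⊛ p)    ≈⟨ ⊛-congʳ g (h-assoc f p) ⟨
  g ⊛ (h ⊛ (f ⊛ p))    ∎
  where open ≐-Reasoning

-- Counting pairs of compositions by their first parts

private variable
  A B : Set

sumOver : List A → (A → ℤ) → ℤ
sumOver []       f = + 0
sumOver (x ∷ xs) f = f x + sumOver xs f

sumOver-cong : ∀ {f g : A → ℤ} xs → (∀ x → f x ≡ g x) → sumOver xs f ≡ sumOver xs g
sumOver-cong []       f≗g = refl
sumOver-cong (x ∷ xs) f≗g = cong₂ _+_ (f≗g x) (sumOver-cong xs f≗g)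

sumOver-zero : ∀ (xs : List A) → sumOver xs (λ _ → + 0) ≡ + 0
sumOver-zero []       = refl
sumOver-zero (x ∷ xs) = trans (ℤ.+-identityˡ _) (sumOver-zero xs)

sumOver-when : ∀ β (f : A → ℤ) xs → sumOver xs (λ x → when β (f x)) ≡ when β (sumOver xs f)
sumOver-when true  f xs = refl
sumOver-when false f xs = sumOver-zero xs

sumOver-++ : ∀ (xs ys : List A) f → sumOver (xs ++ ys) f ≡ sumOver xs f + sumOver ys f
sumOver-++ []       ys f = sym (ℤ.+-identityˡ _)
sumOver-++ (x ∷ xs) ys f = trans (cong (λ t → f x + t) (sumOver-++ xs ys f)) (sym (ℤ.+-assoc (f x) _ _))

sumOver-map : ∀ (g : A → B) xs f → sumOver (List.map g xs) f ≡ sumOver xs (λ x → f (g x))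
sumOver-map g []       f = refl
sumOver-map g (x ∷ xs) f = cong (λ t → f (g x) + t) (sumOver-map g xs f)

sumOver-concatMap : ∀ (g : A → List B) xs f →
                    sumOver (concatMap g xs) f ≡ sumOver xs (λ x → sumOver (g x) f)
sumOver-concatMap g []       f = refl
sumOver-concatMap g (x ∷ xs) f =
  trans (sumOver-++ (g x) _ f) (cong (λ t → sumOver (g x) f + t) (sumOver-concatMap g xs f))

sumOver-cartesianProduct : ∀ (xs : List A) (ys : List B) f →
  sumOver (cartesianProduct xs ys) f ≡ sumOver xs (λ x → sumOver ys (λ y → f (x , y)))
sumOver-cartesianProduct []       ys f = refl
sumOver-cartesianProduct (x ∷ xs) ys f =
  trans (sumOver-++ (List.map (x ,_) ys) _ f)
        (cong₂ _+_ (sumOver-map (x ,_) ys f) (sumOver-cartesianProduct xs ys f))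

sumOver-filter : ∀ {P : A → Set} (P? : Decidable P) xs f →
                 sumOver (filter P? xs) f ≡ sumOver xs (λ x → when (does (P? x)) (f x))
sumOver-filter P? []       f = refl
sumOver-filter P? (x ∷ xs) f with does (P? x)
... | true  = cong (λ t → f x + t) (sumOver-filter P? xs f)
... | false = trans (sumOver-filter P? xs f) (sym (ℤ.+-identityˡ _))

length-sumOver : ∀ (xs : List A) → + length xs ≡ sumOver xs (λ _ → + 1)
length-sumOver []       = refl
length-sumOver (x ∷ xs) = cong (λ t → + 1 + t) (length-sumOver xs)

sumOver-sumTo : ∀ xs (f : A → ℕ → ℤ) n →
  sumOver xs (λ x → sumTo (f x) n) ≡ sumTo (λ i → sumOver xs (λ x → f x i)) n
sumOver-sumTo []       f n = sym (sumTo-zero n)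
sumOver-sumTo (x ∷ xs) f n =
  trans (cong (λ t → sumTo (f x) n + t) (sumOver-sumTo xs f n)) (sym (sumTo-zipWith _+_ medial _ _ n))
  where
  medial : ∀ p q r s → (p + q) + (r + s) ≡ (p + r) + (q + s)
  medial = solve-∀

sumOver-applyUpTo : ∀ (g : ℕ → A) n f → sumOver (applyUpTo g (suc n)) f ≡ sumTo (λ i → f (g i)) n
sumOver-applyUpTo g zero    f = ℤ.+-identityʳ _
sumOver-applyUpTo g (suc n) f =
  trans (cong (λ t → f (g 0) + t) (sumOver-applyUpTo (λ i → g (suc i)) n f))
        (sym (sumTo-suc (λ i → f (g i)) n))

sumOver-boxes-suc : ∀ m r (f : Vec ℕ (suc r) → ℤ) →
  sumOver (boxes m (suc r)) f ≡ sumTo (λ x → sumOver (boxes m r) (λ u → f (x Vec.∷ u))) m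
sumOver-boxes-suc m r f =
  trans (sumOver-concatMap (λ x → List.map (x Vec.∷_) (boxes m r)) (upTo (suc m)) f)
  (trans (sumOver-cong (upTo (suc m)) (λ x → sumOver-map (x Vec.∷_) (boxes m r) f))
         (sumOver-applyUpTo (λ x → x) m _))

admissible : ℕ → ℕ → ℕ → Bool
admissible d x w = (1 ≤ᵇ x) ∧ (1 ≤ᵇ w) ∧ (∣ x - w ∣ ≤ᵇ d)

prepend : (ℕ → ℕ → ℕ → ℤ) → ℕ → ℕ → ℕ → ℤ
prepend g a b d =
  sumTo (λ x → sumTo (λ w → when (admissible d x w) (g (a ∸ x) (b ∸ w) (d ∸ ∣ x - w ∣))) b) a

weight : ∀ {r} → ℕ → ℕ → ℕ → Vec ℕ r → Vec ℕ r → ℤ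
weight a b d u v = 𝕀 (does (isComp? a u) ∧ does (isComp? b v) ∧ does (dist u v ℕ.≟ d))

weight-∷ : ∀ {r} a b d x w (u v : Vec ℕ r) →
  weight a b d (x Vec.∷ u) (w Vec.∷ v) ≡
  when ((x ≤ᵇ a) ∧ (w ≤ᵇ b) ∧ admissible d x w) (weight (a ∸ x) (b ∸ w) (d ∸ ∣ x - w ∣) u v)
weight-∷ a b d x w u v
  rewrite +-≡ᵇ x (Vec.sum u) a | +-≡ᵇ w (Vec.sum v) b | +-≡ᵇ ∣ x - w ∣ (dist u v) d =
  trans (cong 𝕀 (rearrange (1 ≤ᵇ x) _ (x ≤ᵇ a) _ (1 ≤ᵇ w) _ (w ≤ᵇ b) _ (∣ x - w ∣ ≤ᵇ d) _))
        (when-∧ ((x ≤ᵇ a) ∧ (w ≤ᵇ b) ∧ admissible d x w) _ (+ 1))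
  where
  open ∨-∧-Solver
  rearrange : ∀ p A l S q B m S′ e D →
    ((p ∧ A) ∧ (l ∧ S)) ∧ ((q ∧ B) ∧ (m ∧ S′)) ∧ (e ∧ D) ≡ (l ∧ m ∧ p ∧ q ∧ e) ∧ (A ∧ S) ∧ (B ∧ S′) ∧ D
  rearrange = solve 10 (λ p A l S q B m S′ e D →
    ((p :* A) :* (l :* S)) :* (((q :* B) :* (m :* S′)) :* (e :* D)) :=
    (l :* (m :* (p :* (q :* e)))) :* ((A :* S) :* ((B :* S′) :* D))) refl

-- The tuples range over boxes [0, M]ʳ × [0, M′]ʳ; N is the case M, M′ = a, b, but cutting off
-- the first parts lowers a and b while the boxes stay put.
boxCount : ℕ → ℕ → ℕ → ℕ → ℕ → ℕ → ℤ
boxCount M M′ a b r d = sumOver (boxes M r) (λ u → sumOver (boxes M′ r) (λ v → weight a b d u v))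

N≡boxCount : ∀ a b r d → + N a b r d ≡ boxCount a b a b r d
N≡boxCount a b r d = begin
  + N a b r d
    ≡⟨ length-sumOver (filter close? compositionPairs) ⟩
  sumOver (filter close? compositionPairs) (λ _ → + 1)
    ≡⟨ sumOver-filter close? compositionPairs (λ _ → + 1) ⟩
  sumOver compositionPairs (λ p → 𝕀 (does (close? p)))
    ≡⟨ sumOver-cartesianProduct (S a r) (S b r) _ ⟩
  sumOver (S a r) (λ u → sumOver (S b r) (λ v → 𝕀 (close u v)))
    ≡⟨ sumOver-filter (isComp? a) (boxes a r) _ ⟩
  sumOver (boxes a r) (λ u → when (comp a u) (sumOver (S b r) (λ v → 𝕀 (close u v))))
    ≡⟨ sumOver-cong (boxes a r) (λ u → cong (when (comp a u)) (sumOver-filter (isComp? b) (boxes b r) _)) ⟩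
  sumOver (boxes a r) (λ u → when (comp a u) (sumOver (boxes b r) (λ v → when (comp b v) (𝕀 (close u v)))))
    ≡⟨ sumOver-cong (boxes a r) (λ u → sym (sumOver-when (comp a u) _ (boxes b r))) ⟩
  sumOver (boxes a r) (λ u → sumOver (boxes b r) (λ v → when (comp a u) (when (comp b v) (𝕀 (close u v)))))
    ≡⟨ sumOver-cong (boxes a r) (λ u → sumOver-cong (boxes b r) (λ v → sym
         (trans (when-∧ (comp a u) _ (+ 1)) (cong (when (comp a u)) (when-∧ (comp b v) _ (+ 1)))))) ⟩
  boxCount a b a b r d
    ∎
  where
  open ≡-Reasoning
  comp : ℕ → Vec ℕ r → Bool
  comp n u = does (isComp? n u)
  close : Vec ℕ r → Vec ℕ r → Bool
  close u v = does (dist u v ℕ.≟ d)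
  compositionPairs = cartesianProduct (S a r) (S b r)
  close? = λ (p : Vec ℕ r × Vec ℕ r) → dist (proj₁ p) (proj₂ p) ℕ.≟ d

boxCount-suc : ∀ {M M′ a b} r d → a ≤ M → b ≤ M′ →
  boxCount M M′ a b (suc r) d ≡ prepend (λ a′ b′ d′ → boxCount M M′ a′ b′ r d′) a b d
boxCount-suc {M} {M′} {a} {b} r d a≤M b≤M′ = begin
  boxCount M M′ a b (suc r) d
    ≡⟨ sumOver-boxes-suc M r _ ⟩
  sumTo (λ x → sumOver (boxes M r) (λ u → sumOver (boxes M′ (suc r)) (λ v → weight a b d (x Vec.∷ u) v))) M
    ≡⟨ sumTo-cong (λ x → sumOver-cong (boxes M r) (λ u → sumOver-boxes-suc M′ r _)) M ⟩
  sumTo (λ x → sumOver (boxes M r) (λ u → sumTo (λ w → Σv x w u) M′)) M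
    ≡⟨ sumTo-cong (λ x → sumOver-sumTo (boxes M r) (λ u w → Σv x w u) M′) M ⟩
  sumTo (λ x → sumTo (λ w → sumOver (boxes M r) (Σv x w)) M′) M
    ≡⟨ sumTo-cong (λ x → sumTo-cong (λ w → first-parts x w) M′) M ⟩
  sumTo (λ x → sumTo (λ w → when (x ≤ᵇ a) (when (w ≤ᵇ b) (rest x w))) M′) M
    ≡⟨ sumTo-cong (λ x → sumTo-when (x ≤ᵇ a) _ M′) M ⟩
  sumTo (λ x → when (x ≤ᵇ a) (sumTo (λ w → when (w ≤ᵇ b) (rest x w)) M′)) M
    ≡⟨ sumTo-truncate _ a≤M ⟩
  sumTo (λ x → sumTo (λ w → when (w ≤ᵇ b) (rest x w)) M′) a
    ≡⟨ sumTo-cong (λ x → sumTo-truncate (rest x) b≤M′) a ⟩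
  prepend (λ a′ b′ d′ → boxCount M M′ a′ b′ r d′) a b d
    ∎
  where
  open ≡-Reasoning
  Σv : ℕ → ℕ → Vec ℕ r → ℤ
  Σv x w u = sumOver (boxes M′ r) (λ v → weight a b d (x Vec.∷ u) (w Vec.∷ v))
  rest : ℕ → ℕ → ℤ
  rest x w = when (admissible d x w) (boxCount M M′ (a ∸ x) (b ∸ w) r (d ∸ ∣ x - w ∣))
  first-parts : ∀ x w → sumOver (boxes M r) (Σv x w) ≡ when (x ≤ᵇ a) (when (w ≤ᵇ b) (rest x w))
  first-parts x w =
    trans (sumOver-cong (boxes M r) (λ u →
             trans (sumOver-cong (boxes M′ r) (weight-∷ a b d x w u)) (sumOver-when guard _ (boxes M′ r))))
    (trans (sumOver-when guard _ (boxes M r))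
           (trans (when-∧ (x ≤ᵇ a) _ _) (cong (when (x ≤ᵇ a)) (when-∧ (w ≤ᵇ b) _ _))))
    where guard = (x ≤ᵇ a) ∧ (w ≤ᵇ b) ∧ admissible d x w

boxCount-bounds : ∀ {M M′ a b} r d → a ≤ M → b ≤ M′ → boxCount M M′ a b r d ≡ boxCount a b a b r d
boxCount-bounds zero    d a≤M b≤M′ = refl
boxCount-bounds {a = a} {b} (suc r) d a≤M b≤M′ =
  trans (boxCount-suc r d a≤M b≤M′)
  (trans (sumTo-cong (λ x → sumTo-cong (λ w → cong (when _)
           (trans (boxCount-bounds r _ (∸-≤ x a≤M) (∸-≤ w b≤M′))
                  (sym (boxCount-bounds r _ (∸-≤ x ℕ.≤-refl) (∸-≤ w ℕ.≤-refl))))) b) a)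
         (sym (boxCount-suc r d ℕ.≤-refl ℕ.≤-refl)))
  where
  ∸-≤ : ∀ {m n} k → m ≤ n → m ∸ k ≤ n
  ∸-≤ {m} k m≤n = ℕ.≤-trans (ℕ.m∸n≤m m k) m≤n

N-zero : ∀ a b d → + N a b 0 d ≡ 𝟙 a b 0 d
N-zero zero    zero    zero    = refl
N-zero zero    zero    (suc d) = refl
N-zero zero    (suc b) d       = refl
N-zero (suc a) b       d       = refl

N-suc : ∀ a b r d → + N a b (suc r) d ≡ prepend (λ a′ b′ d′ → + N a′ b′ r d′) a b d
N-suc a b r d =
  trans (N≡boxCount a b (suc r) d)
  (trans (boxCount-suc r d ℕ.≤-refl ℕ.≤-refl)
         (sumTo-cong (λ x → sumTo-cong (λ w → cong (when _)
           (trans (boxCount-bounds r _ (ℕ.m∸n≤m a x) (ℕ.m∸n≤m b w)) (sym (N≡boxCount _ _ r _)))) b) a))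

pairs : PS
pairs _       _       (suc _) _ = + 0
pairs (suc i) (suc j) zero    d = 𝕀 (d ≡ᵇ ∣ i - j ∣)
pairs _       _       zero    _ = + 0

pairs-⊛ : ∀ f a b c d → (pairs ⊛ f) a b c d ≡ prepend (λ a′ b′ d′ → f a′ b′ c d′) a b d
pairs-⊛ f a b c d = sumTo-cong (λ x → sumTo-cong (λ w →
  trans (sumTo-head (λ _ → sumTo-zero d) c) (column x w)) b) a
  where
  column : ∀ x w → sumTo (λ l → pairs x w 0 l * f (a ∸ x) (b ∸ w) c (d ∸ l)) d ≡
                   when (admissible d x w) (f (a ∸ x) (b ∸ w) c (d ∸ ∣ x - w ∣))
  column zero    w       = sumTo-zero d
  column (suc x) zero    = sumTo-zero d
  column (suc x) (suc w) = trans (sumTo-cong (λ l → 𝕀-*ˡ (l ≡ᵇ ∣ x - w ∣) _) d) (sumTo-δ ∣ x - w ∣ d _)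

F-recursion : F ≐ 𝟙 ⊕ y ⊛ (pairs ⊛ F)
F-recursion a b zero    d =
  trans (N-zero a b d) (sym (trans (cong (λ t → 𝟙 a b 0 d + t) (mono-⊛ 0 0 1 0 (pairs ⊛ F) a b 0 d))
                                   (ℤ.+-identityʳ _)))
F-recursion a b (suc r) d =
  trans (N-suc a b r d)
  (sym (trans (cong₂ _+_ (mono-y-free 0 0 0 a b r d)
                         (trans (mono-⊛ 0 0 1 0 (pairs ⊛ F) a b (suc r) d) (pairs-⊛ F a b r d)))
              (ℤ.+-identityˡ _)))

-- The coefficient identity G·P = x₁x₂(1 − x₁x₂z²)

corner : PS
corner _             _       (suc _) _ = + 0
corner 1             (suc j) zero    d = 𝕀 (d ≡ᵇ j)
corner (suc (suc i)) 1       zero    d = 𝕀 (d ≡ᵇ suc i)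
corner _             _       zero    _ = + 0

twoRows : PS
twoRows _             _ (suc _) _ = + 0
twoRows 1             1 zero    0 = + 1
twoRows (suc (suc i)) 1 zero    d = 𝕀 (d ≡ᵇ suc i)
twoRows (suc (suc i)) 2 zero    d = - 𝕀 (d ≡ᵇ suc (suc i))
twoRows _             _ zero    _ = + 0

Δ-pairs : Δ 1 1 0 0 pairs ≐ corner
Δ-pairs a             b             (suc c) d = Δ-beyond 1 1 0 0 pairs a b (suc c) d refl
Δ-pairs zero          b             zero    d = refl
Δ-pairs 1             zero          zero    d = refl
Δ-pairs 1             (suc b)       zero    d = ℤ.+-identityʳ _
Δ-pairs (suc (suc a)) zero          zero    d = refl
Δ-pairs (suc (suc a)) 1             zero    d = ℤ.+-identityʳ _
Δ-pairs (suc (suc a)) (suc (suc b)) zero    d = ℤ.+-inverseʳ (𝕀 (d ≡ᵇ ∣ a - b ∣))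

Δ-corner : Δ 0 1 0 1 corner ≐ twoRows
Δ-corner a             b                   (suc c) d       = Δ-beyond 0 1 0 1 corner a b (suc c) d refl
Δ-corner zero          b                   zero    d       = Δ-beyond 0 1 0 1 corner 0 b 0 d refl
Δ-corner 1             zero                zero    d       = refl
Δ-corner 1             1                   zero    zero    = refl
Δ-corner 1             1                   zero    (suc d) = refl
Δ-corner 1             (suc (suc b))       zero    zero    = refl
Δ-corner 1             (suc (suc b))       zero    (suc d) = ℤ.+-inverseʳ (𝕀 (d ≡ᵇ b))
Δ-corner (suc (suc a)) zero                zero    d       = refl
Δ-corner (suc (suc a)) 1                   zero    d       =
  Δ-beyond 0 1 0 1 corner (suc (suc a)) 1 0 d refl
Δ-corner (suc (suc a)) 2                   zero    zero    = refl
Δ-corner (suc (suc a)) 2                   zero    (suc d) = ℤ.+-identityˡ _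
Δ-corner (suc (suc a)) (suc (suc (suc b))) zero    d       =
  Δ-beyond 0 1 0 1 corner (suc (suc a)) (suc (suc (suc b))) 0 d refl

Δ-twoRows : Δ 1 0 0 1 twoRows ≐ mono 1 1 0 0 ⊖ mono 2 2 0 2
Δ-twoRows a b (suc c) d =
  trans (Δ-beyond 1 0 0 1 twoRows a b (suc c) d refl)
        (sym (cong₂ _-_ (mono-y-free 1 1 0 a b c d) (mono-y-free 2 2 2 a b c d)))
Δ-twoRows zero                b                   zero d             = refl
Δ-twoRows 1                   zero                zero d             = Δ-beyond 1 0 0 1 twoRows 1 0 0 d refl
Δ-twoRows 1                   1                   zero zero          = Δ-beyond 1 0 0 1 twoRows 1 1 0 0 refl
Δ-twoRows 1                   1                   zero (suc d)       =
  Δ-beyond 1 0 0 1 twoRows 1 1 0 (suc d) refl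
Δ-twoRows 1                   (suc (suc b))       zero d             =
  Δ-beyond 1 0 0 1 twoRows 1 (suc (suc b)) 0 d refl
Δ-twoRows 2                   zero                zero d             = Δ-beyond 1 0 0 1 twoRows 2 0 0 d refl
Δ-twoRows 2                   1                   zero zero          = refl
Δ-twoRows 2                   1                   zero 1             = refl
Δ-twoRows 2                   1                   zero (suc (suc d)) = refl
Δ-twoRows 2                   2                   zero d             =
  trans (Δ-beyond 1 0 0 1 twoRows 2 2 0 d refl) (sym (ℤ.+-identityˡ _))
Δ-twoRows 2                   (suc (suc (suc b))) zero d             =
  Δ-beyond 1 0 0 1 twoRows 2 (suc (suc (suc b))) 0 d refl
Δ-twoRows (suc (suc (suc a))) zero                zero d             =
  Δ-beyond 1 0 0 1 twoRows (suc (suc (suc a))) 0 0 d refl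
Δ-twoRows (suc (suc (suc a))) 1                   zero zero          = refl
Δ-twoRows (suc (suc (suc a))) 1                   zero (suc d)       = ℤ.+-inverseʳ (𝕀 (d ≡ᵇ suc a))
Δ-twoRows (suc (suc (suc a))) 2                   zero zero          = refl
Δ-twoRows (suc (suc (suc a))) 2                   zero (suc d)       = ℤ.+-inverseʳ (- 𝕀 (d ≡ᵇ suc (suc a)))
Δ-twoRows (suc (suc (suc a))) (suc (suc (suc b))) zero d             =
  Δ-beyond 1 0 0 1 twoRows (suc (suc (suc a))) (suc (suc (suc b))) 0 d refl

W : PS
W = 𝟙 ⊖ x₁ ⊛ x₂ ⊛ z ⊛ z

-- Spelled out so that H is literally G ⊖ Y.
Y : PS
Y = y ⊛ x₁ ⊛ x₂ ⊛ W

x₁x₂-⊛-W : (x₁ ⊛ x₂) ⊛ W ≐ mono 1 1 0 0 ⊖ mono 2 2 0 2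
x₁x₂-⊛-W = begin
  (x₁ ⊛ x₂) ⊛ W
    ≈⟨ ⊛-distribˡ-⊖ (x₁ ⊛ x₂) 𝟙 x₁x₂z² ⟩
  (x₁ ⊛ x₂) ⊛ 𝟙 ⊖ (x₁ ⊛ x₂) ⊛ x₁x₂z²
    ≈⟨ ⊖-cong (⊛-identityʳ (x₁ ⊛ x₂)) (≐-refl {(x₁ ⊛ x₂) ⊛ x₁x₂z²}) ⟩
  x₁ ⊛ x₂ ⊖ (x₁ ⊛ x₂) ⊛ x₁x₂z²
    ≈⟨ ⊖-cong x₁x₂≐ (⊛-cong x₁x₂≐ x₁x₂z²≐) ⟩
  mono 1 1 0 0 ⊖ mono 1 1 0 0 ⊛ mono 1 1 0 2
    ≈⟨ ⊖-cong (≐-refl {mono 1 1 0 0}) (mono-⊛-mono 1 1 0 0 1 1 0 2) ⟩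
  mono 1 1 0 0 ⊖ mono 2 2 0 2
    ∎
  where
  open ≐-Reasoning
  x₁x₂z² = x₁ ⊛ x₂ ⊛ z ⊛ z
  x₁x₂≐ : x₁ ⊛ x₂ ≐ mono 1 1 0 0
  x₁x₂≐ = mono-⊛-mono 1 0 0 0 0 1 0 0
  x₁x₂z²≐ : x₁x₂z² ≐ mono 1 1 0 2
  x₁x₂z²≐ = ≐-trans (⊛-congˡ z (≐-trans (⊛-congˡ z x₁x₂≐) (mono-⊛-mono 1 1 0 0 0 0 0 1)))
                    (mono-⊛-mono 1 1 0 1 0 0 0 1)

G-⊛-pairs : G ⊛ pairs ≐ (x₁ ⊛ x₂) ⊛ W
G-⊛-pairs = begin
  G ⊛ pairs
    ≈⟨ ⊛-rotate {𝟙 ⊖ x₁ ⊛ z} {𝟙 ⊖ x₂ ⊛ z} (one-minus-associates 1 0 0 0 0 0 0 1)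
                                         (one-minus-associates 0 1 0 0 0 0 0 1) (𝟙 ⊖ x₁ ⊛ x₂) pairs ⟩
  (𝟙 ⊖ x₁ ⊛ z) ⊛ ((𝟙 ⊖ x₂ ⊛ z) ⊛ ((𝟙 ⊖ x₁ ⊛ x₂) ⊛ pairs))
    ≈⟨ ⊛-congʳ (𝟙 ⊖ x₁ ⊛ z) (⊛-congʳ (𝟙 ⊖ x₂ ⊛ z) (one-minus-⊛ 1 0 0 0 0 1 0 0 pairs)) ⟩
  (𝟙 ⊖ x₁ ⊛ z) ⊛ ((𝟙 ⊖ x₂ ⊛ z) ⊛ Δ 1 1 0 0 pairs)
    ≈⟨ ⊛-congʳ (𝟙 ⊖ x₁ ⊛ z) (one-minus-⊛ 0 1 0 0 0 0 0 1 (Δ 1 1 0 0 pairs)) ⟩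
  (𝟙 ⊖ x₁ ⊛ z) ⊛ Δ 0 1 0 1 (Δ 1 1 0 0 pairs)
    ≈⟨ one-minus-⊛ 1 0 0 0 0 0 0 1 (Δ 0 1 0 1 (Δ 1 1 0 0 pairs)) ⟩
  Δ 1 0 0 1 (Δ 0 1 0 1 (Δ 1 1 0 0 pairs))    ≈⟨ Δ-cong 1 0 0 1 (Δ-cong 0 1 0 1 Δ-pairs) ⟩
  Δ 1 0 0 1 (Δ 0 1 0 1 corner)               ≈⟨ Δ-cong 1 0 0 1 Δ-corner ⟩
  Δ 1 0 0 1 twoRows                          ≈⟨ Δ-twoRows ⟩
  mono 1 1 0 0 ⊖ mono 2 2 0 2                ≈⟨ x₁x₂-⊛-W ⟨
  (x₁ ⊛ x₂) ⊛ W                              ∎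
  where open ≐-Reasoning

G-associates : Associates G
G-associates =
  ⊛-associates {(𝟙 ⊖ x₁ ⊛ x₂) ⊛ (𝟙 ⊖ x₁ ⊛ z)} {𝟙 ⊖ x₂ ⊛ z}
    (⊛-associates {𝟙 ⊖ x₁ ⊛ x₂} {𝟙 ⊖ x₁ ⊛ z} (one-minus-associates 1 0 0 0 0 1 0 0)
                                              (one-minus-associates 1 0 0 0 0 0 0 1))
    (one-minus-associates 0 1 0 0 0 0 0 1)

G-⊛-y-pairs : ∀ f → G ⊛ (y ⊛ (pairs ⊛ f)) ≐ Y ⊛ f
G-⊛-y-pairs f = begin
  G ⊛ (y ⊛ (pairs ⊛ f))         ≈⟨ G-associates y (pairs ⊛ f) ⟩
  (G ⊛ y) ⊛ (pairs ⊛ f)         ≈⟨ ⊛-congˡ (pairs ⊛ f) (⊛-comm G y) ⟩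
  (y ⊛ G) ⊛ (pairs ⊛ f)         ≈⟨ y-associates G (pairs ⊛ f) ⟨
  y ⊛ (G ⊛ (pairs ⊛ f))         ≈⟨ ⊛-congʳ y (G-associates pairs f) ⟩
  y ⊛ ((G ⊛ pairs) ⊛ f)         ≈⟨ ⊛-congʳ y (⊛-congˡ f G-⊛-pairs) ⟩
  y ⊛ (((x₁ ⊛ x₂) ⊛ W) ⊛ f)     ≈⟨ y-associates ((x₁ ⊛ x₂) ⊛ W) f ⟩
  (y ⊛ ((x₁ ⊛ x₂) ⊛ W)) ⊛ f     ≈⟨ ⊛-congˡ f reassociate ⟩
  Y ⊛ f                         ∎
  where
  open ≐-Reasoning
  y-associates = mono-associates 0 0 1 0
  reassociate : y ⊛ ((x₁ ⊛ x₂) ⊛ W) ≐ Y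
  reassociate =
    ≐-trans (⊛-congʳ y (≐-sym (mono-associates 1 0 0 0 x₂ W)))
    (≐-trans (y-associates x₁ (x₂ ⊛ W)) (⊛-associates {y} {x₁} y-associates (mono-associates 1 0 0 0) x₂ W))

lemma3 : (a b c d : ℕ) → (F ⊛ H) a b c d ≡ G a b c d
lemma3 = begin
  F ⊛ H                  ≈⟨ ⊛-comm F H ⟩
  H ⊛ F                  ≈⟨ ⊛-distribʳ-⊖ G Y F ⟩
  G ⊛ F ⊖ Y ⊛ F          ≈⟨ ⊖-cong G⊛F (≐-refl {Y ⊛ F}) ⟩
  (G ⊕ Y ⊛ F) ⊖ Y ⊛ F    ≈⟨ (λ a b c d → cancel (G a b c d) ((Y ⊛ F) a b c d)) ⟩
  G                      ∎
  where
  open ≐-Reasoning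
  cancel : ∀ g t → (g + t) - t ≡ g
  cancel = solve-∀
  G⊛F : G ⊛ F ≐ G ⊕ Y ⊛ F
  G⊛F = begin
    G ⊛ F                                ≈⟨ ⊛-congʳ G F-recursion ⟩
    G ⊛ (𝟙 ⊕ y ⊛ (pairs ⊛ F))            ≈⟨ ⊛-distribˡ-⊕ G 𝟙 (y ⊛ (pairs ⊛ F)) ⟩
    G ⊛ 𝟙 ⊕ G ⊛ (y ⊛ (pairs ⊛ F))        ≈⟨ ⊕-cong (⊛-identityʳ G) (G-⊛-y-pairs F) ⟩
    G ⊕ Y ⊛ F                            ∎
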